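{- If a $(v,k,\lambda)$-BIBD with replication number $r=\frac{\lambda(v-1)}{k-1}$ admits a $0$-ULSE $\ell$-colouring, then $\frac{r}{\ell-1}\in\mathbb{Z}$.
   Context: For positive integers $v,k,\lambda$ with $2\le k<v$, a $(v,k,\lambda)$-BIBD is a pair $(V,\mathcal{B})$ where $V$ is a set of $v$ points and $\mathcal{B}$ is a collection of $k$-element subsets of $V$ (blocks) such that every pair of distinct points lies in exactly $\lambda$ blocks; each point lies in exactly $r=\lambda(v-1)/(k-1)$ blocks. An $\ell$-colouring is a surjective map from $V$ onto a set of $\ell$ colours. A $0$-ULSE $\ell$-colouring is an $\ell$-colouring such that $(\ell-1)$ divides $k$ and in every block exactly one colour does not appear, while each of the other $\ell-1$ colours appears exactly $\frac{k}{\ell-1}$ times in that block. -}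

module Defs where

open import Data.Nat using (ℕ; _+_; _*_; _∸_; _≤_; _<_)
open import Data.Nat.Divisibility using (_∣_)
open import Data.Fin using (Fin)
open import Data.Fin.Properties using () renaming (_≟_ to _≟ᶠ_)
open import Data.Fin.Subset using (Subset; _∈_; _∉_; ∣_∣)
open import Data.Fin.Subset.Properties using (_∈?_)
open import Data.List using (List; length; filter; allFin)
import Data.List.Membership.Propositional as L
open import Data.Product using (Σ; ∃; _×_; _,_)
open import Relation.Binary.PropositionalEquality using (_≡_; _≢_)
open import Relation.Nullary using (¬_)
open import Relation.Nullary.Decidable using (_×-dec_)
open import Function.Definitions using (Surjective)

-- Points are Fin v; a block is a subset of the point set (Subset v);
-- the collection of blocks is a List, so repeated blocks are allowed.

pairCount : ∀ {v} → List (Subset v) → Fin v → Fin v → ℕ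
pairCount B x y = length (filter (λ b → (x ∈? b) ×-dec (y ∈? b)) B)

record IsBIBD (v k λ' : ℕ) (B : List (Subset v)) : Set where
  field
    two≤k     : 2 ≤ k
    k<v       : k < v
    pos-λ     : 1 ≤ λ'
    blockSize : ∀ b → b L.∈ B → ∣ b ∣ ≡ k
    balanced  : ∀ x y → x ≢ y → pairCount B x y ≡ λ'

colourCount : ∀ {v ℓ} → (Fin v → Fin ℓ) → Subset v → Fin ℓ → ℕ
colourCount {v} c b j = length (filter (λ x → (x ∈? b) ×-dec (c x ≟ᶠ j)) (allFin v))

IsColouring : ∀ {v ℓ} → (Fin v → Fin ℓ) → Set
IsColouring c = Surjective _≡_ _≡_ c

-- 0-ULSE ℓ-colouring of the design with blocks B and block size k:
-- (ℓ-1) ∣ k, and in every block exactly one colour is missing, while every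
-- other colour appears exactly k/(ℓ-1) times (stated multiplicatively:
-- count * (ℓ-1) ≡ k, which is equivalent given (ℓ-1) ∣ k and ℓ-1 ≠ 0).
record Is0ULSE {v} (k ℓ : ℕ) (B : List (Subset v)) (c : Fin v → Fin ℓ) : Set where
  field
    colouring : IsColouring c
    divides   : (ℓ ∸ 1) ∣ k
    missing   : ∀ b → b L.∈ B → Σ (Fin ℓ) λ j →
                  colourCount c b j ≡ 0 ×
                  (∀ j' → j' ≢ j → colourCount c b j' * (ℓ ∸ 1) ≡ k)

module Submission where

-- Let m = k/(ℓ-1) and fix a point x of colour a.  Counting the flags
-- (y, b) with x, y ∈ b in two ways gives r_x (k-1) = λ (v-1), so every
-- replication number equals r.  For a colour j ≠ a let R_j be the number of
-- blocks through x that miss j and N_j the size of the colour class j.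
-- Counting the flags (y, b) with x, y ∈ b and y of colour j from x gives
-- λ N_j + m R_j = m r; counting them from a point z of colour j gives
-- m r + λ = r + λ N_j.  Hence m R_j + λ = r, so R_j = t does not depend on j.
-- Every block through x misses exactly one colour, never a, so
-- r = Σ_j R_j = (ℓ-1) t.

open import Algebra.Properties.CommutativeSemigroup using (x∙yz≈y∙xz; xy∙z≈x∙zy)
open import Data.Bool.Base using (if_then_else_; true; false)
open import Data.Fin.Base using (Fin; zero; suc; punchIn; fromℕ<)
open import Data.Fin.Properties using (suc-injective; punchInᵢ≢i) renaming (_≟_ to _≟ᶠ_)
open import Data.Fin.Subset using (Subset; _∈_; ∣_∣; inside; outside)
open import Data.Fin.Subset.Properties using (_∈?_)
open import Data.List.Base using (List; _∷_; length; filter; tabulate; lookup)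
import Data.List.Membership.Propositional as List
open import Data.List.Membership.Propositional.Properties using (∈-filter⁺; ∈-allFin; ∈-lookup)
open import Data.List.Properties using (tabulate-lookup)
open import Data.Nat.Base
  using (ℕ; zero; suc; _+_; _*_; _∸_; _≤_; _<_; s≤s; z≤n; NonZero; >-nonZero; ≢-nonZero⁻¹)
open import Data.Nat.Divisibility using (_∣_; divides)
open import Data.Nat.Properties
  using ( _≟_; +-*-semiring; +-commutativeSemigroup; +-assoc; +-comm; +-identityʳ
        ; +-cancelˡ-≡; +-cancelʳ-≡; *-comm; *-identityˡ; *-identityʳ; *-zeroʳ; *-suc
        ; *-cancelˡ-≡; *-cancelʳ-≡; *-distribʳ-∸; m*n≢0⇒m≢0; m*n≢0⇒n≢0; m+n∸n≡m
        ; m≤n⇒m∸n≡0; ≰⇒>; ≤-trans; ≤-<-trans; ∸-monoˡ-≤)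
open import Data.Nat.Tactic.RingSolver using (solve-∀)
open import Data.Product using (∃-syntax; _,_; proj₁; proj₂)
open import Data.Vec.Base using ([]; _∷_)
open import Function.Base using (_∘_; id)
open import Level using (Level)
open import Relation.Binary.PropositionalEquality
open import Relation.Nullary using (Dec; does; yes; no; ¬_; contradiction)
open import Relation.Nullary.Decidable using (_×-dec_)
open import Relation.Unary using (Pred; Decidable)

open import Algebra.Properties.Semiring.Sum +-*-semiring
open import Defs

private
  variable
    a p q : Level
    A : Set a
    P : Set p
    Q : Set q

𝟙 : Dec P → ℕ
𝟙 P? = if does P? then 1 else 0

𝟙-yes : (P? : Dec P) → P → 𝟙 P? ≡ 1
𝟙-yes (yes _) _ = refl
𝟙-yes (no ¬p) p = contradiction p ¬p

𝟙-no : (P? : Dec P) → ¬ P → 𝟙 P? ≡ 0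
𝟙-no (yes p) ¬p = contradiction p ¬p
𝟙-no (no _)  _  = refl

𝟙-×-dec : (P? : Dec P) (Q? : Dec Q) → 𝟙 (P? ×-dec Q?) ≡ 𝟙 P? * 𝟙 Q?
𝟙-×-dec P? Q? with does P? | does Q?
... | true  | true  = refl
... | true  | false = refl
... | false | _     = refl

𝟙-idem : (P? : Dec P) → 𝟙 P? * 𝟙 P? ≡ 𝟙 P?
𝟙-idem P? with does P?
... | true  = refl
... | false = refl

𝟙-*-cong : (P? : Dec P) {m n : ℕ} → (P → m ≡ n) → 𝟙 P? * m ≡ 𝟙 P? * n
𝟙-*-cong (yes p) m≡n = cong (_+ 0) (m≡n p)
𝟙-*-cong (no _)  _   = refl

n+m*𝟙[n≟0]≡m : ∀ {n m} → (n ≢ 0 → n ≡ m) → n + m * 𝟙 (n ≟ 0) ≡ m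
n+m*𝟙[n≟0]≡m {zero}  {m} _   = *-identityʳ m
n+m*𝟙[n≟0]≡m {suc n} {m} n≡m = trans (cong₂ _+_ (n≡m λ ()) (*-zeroʳ m)) (+-identityʳ m)

a*k+b≡a+b*v⇒a*[k∸1]≡b*[v∸1] : ∀ a b {k v} → 1 ≤ k → 1 ≤ v →
                               a * k + b ≡ a + b * v → a * (k ∸ 1) ≡ b * (v ∸ 1)
a*k+b≡a+b*v⇒a*[k∸1]≡b*[v∸1] a b {suc k} {suc v} _ _ eq =
  +-cancelʳ-≡ b _ _ (+-cancelˡ-≡ a _ _ (begin
    a + (a * k + b)  ≡⟨ +-assoc a (a * k) b ⟨
    a + a * k + b    ≡⟨ cong (_+ b) (*-suc a k) ⟨
    a * suc k + b    ≡⟨ eq ⟩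
    a + b * suc v    ≡⟨ cong (a +_) (trans (*-suc b v) (+-comm b (b * v))) ⟩
    a + (b * v + b)  ∎))
  where open ≡-Reasoning

m+n≡o*n⇒m≡n*[o∸1] : ∀ {m n o} → m + n ≡ o * n → m ≡ n * (o ∸ 1)
m+n≡o*n⇒m≡n*[o∸1] {m} {n} {o} eq = begin
  m              ≡⟨ m+n∸n≡m m n ⟨
  m + n ∸ n      ≡⟨ cong (_∸ n) eq ⟩
  o * n ∸ n      ≡⟨ cong (o * n ∸_) (*-identityˡ n) ⟨
  o * n ∸ 1 * n  ≡⟨ *-distribʳ-∸ n o 1 ⟨
  (o ∸ 1) * n    ≡⟨ *-comm (o ∸ 1) n ⟩
  n * (o ∸ 1)    ∎
  where open ≡-Reasoning

another : ∀ {n} → 1 < n → (i : Fin n) → ∃[ j ] j ≢ i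
another {suc zero}    (s≤s ()) i
another {suc (suc n)} _        i = punchIn i zero , punchInᵢ≢i i zero

sum-const : ∀ n t → ∑[ i < n ] t ≡ n * t
sum-const zero    t = refl
sum-const (suc n) t = cong (t +_) (sum-const n t)

sum-cong-except : ∀ {n} (g h : Fin n → ℕ) (x : Fin n) → (∀ y → y ≢ x → g y ≡ h y) →
                  sum g + h x ≡ g x + sum h
sum-cong-except {suc n} g h zero g≡h = begin
  g zero + sum (g ∘ suc) + h zero
    ≡⟨ cong (λ s → g zero + s + h zero) (sum-cong-≗ (λ y → g≡h (suc y) λ ())) ⟩
  g zero + sum (h ∘ suc) + h zero
    ≡⟨ xy∙z≈x∙zy +-commutativeSemigroup (g zero) _ (h zero) ⟩
  g zero + sum h ∎
  where open ≡-Reasoning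
sum-cong-except {suc n} g h (suc x) g≡h = begin
  g zero + sum (g ∘ suc) + h (suc x)
    ≡⟨ +-assoc (g zero) _ _ ⟩
  g zero + (sum (g ∘ suc) + h (suc x))
    ≡⟨ cong (g zero +_) (sum-cong-except (g ∘ suc) (h ∘ suc) x g≡h-suc) ⟩
  g zero + (g (suc x) + sum (h ∘ suc))
    ≡⟨ x∙yz≈y∙xz +-commutativeSemigroup (g zero) (g (suc x)) _ ⟩
  g (suc x) + (g zero + sum (h ∘ suc))
    ≡⟨ cong (λ t → g (suc x) + (t + sum (h ∘ suc))) (g≡h zero λ ()) ⟩
  g (suc x) + sum h ∎
  where
  open ≡-Reasoning
  g≡h-suc : ∀ y → y ≢ x → g (suc y) ≡ h (suc y)
  g≡h-suc y y≢x = g≡h (suc y) (y≢x ∘ suc-injective)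

length-filter-tabulate : ∀ {n} {P : Pred A p} (P? : Decidable P) (f : Fin n → A) →
                         length (filter P? (tabulate f)) ≡ ∑[ i < n ] 𝟙 (P? (f i))
length-filter-tabulate {n = zero}  P? f = refl
length-filter-tabulate {n = suc n} P? f with does (P? (f zero))
... | true  = cong suc (length-filter-tabulate P? (f ∘ suc))
... | false = length-filter-tabulate P? (f ∘ suc)

length≢0 : ∀ {x : A} {xs : List A} → x List.∈ xs → length xs ≢ 0
length≢0 {xs = _ ∷ _} _ ()

∣p∣≡∑∈ : ∀ {n} (p : Subset n) → ∣ p ∣ ≡ ∑[ x < n ] 𝟙 (x ∈? p)
∣p∣≡∑∈ []            = refl
∣p∣≡∑∈ (inside  ∷ p) = cong suc (∣p∣≡∑∈ p)
∣p∣≡∑∈ (outside ∷ p) = ∣p∣≡∑∈ p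

module Incidence {v n : ℕ} (β : Fin n → Subset v) where

  replication : Fin v → ℕ
  replication x = ∑[ i < n ] 𝟙 (x ∈? β i)

  coincidence : Fin v → Fin v → ℕ
  coincidence x y = ∑[ i < n ] (𝟙 (x ∈? β i) * 𝟙 (y ∈? β i))

  weight : (Fin v → ℕ) → Fin n → ℕ
  weight w i = ∑[ y < v ] (𝟙 (y ∈? β i) * w y)

  ∑-through : Fin v → (Fin n → ℕ) → ℕ
  ∑-through x f = ∑[ i < n ] (𝟙 (x ∈? β i) * f i)

  coincidence-diag : ∀ x → coincidence x x ≡ replication x
  coincidence-diag x = sum-cong-≗ (λ i → 𝟙-idem (x ∈? β i))

  ∑-through-cong : ∀ x {f g : Fin n → ℕ} → (∀ i → x ∈ β i → f i ≡ g i) →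
                   ∑-through x f ≡ ∑-through x g
  ∑-through-cong x f≡g = sum-cong-≗ (λ i → 𝟙-*-cong (x ∈? β i) (f≡g i))

  ∑-through-const : ∀ x t → ∑-through x (λ _ → t) ≡ replication x * t
  ∑-through-const x t = sym (*-distribʳ-sum t (λ i → 𝟙 (x ∈? β i)))

  ∑-through-linear : ∀ x f g t → ∑-through x f + t * ∑-through x g ≡ ∑-through x (λ i → f i + t * g i)
  ∑-through-linear x f g t = begin
    ∑-through x f + t * ∑-through x g
      ≡⟨ cong (∑-through x f +_) (*-distribˡ-sum t (λ i → 𝟙 (x ∈? β i) * g i)) ⟩
    ∑-through x f + ∑[ i < n ] (t * (𝟙 (x ∈? β i) * g i))
      ≡⟨ ∑-distrib-+ (λ i → 𝟙 (x ∈? β i) * f i) _ ⟨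
    ∑[ i < n ] (𝟙 (x ∈? β i) * f i + t * (𝟙 (x ∈? β i) * g i))
      ≡⟨ sum-cong-≗ (λ i → distrib (𝟙 (x ∈? β i)) (f i) t (g i)) ⟩
    ∑-through x (λ i → f i + t * g i) ∎
    where
    open ≡-Reasoning
    distrib : ∀ a b t c → a * b + t * (a * c) ≡ a * (b + t * c)
    distrib = solve-∀

  ∑-through-weight : ∀ x w → ∑-through x (weight w) ≡ ∑[ y < v ] (w y * coincidence x y)
  ∑-through-weight x w = begin
    ∑[ i < n ] (𝟙 (x ∈? β i) * weight w i)
      ≡⟨ sum-cong-≗ (λ i → *-distribˡ-sum (𝟙 (x ∈? β i)) (λ y → 𝟙 (y ∈? β i) * w y)) ⟩
    ∑[ i < n ] ∑[ y < v ] (𝟙 (x ∈? β i) * (𝟙 (y ∈? β i) * w y))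
      ≡⟨ ∑-comm (λ i y → 𝟙 (x ∈? β i) * (𝟙 (y ∈? β i) * w y)) ⟩
    ∑[ y < v ] ∑[ i < n ] (𝟙 (x ∈? β i) * (𝟙 (y ∈? β i) * w y))
      ≡⟨ sum-cong-≗ (λ y → sum-cong-≗ (λ i → rotate (𝟙 (x ∈? β i)) (𝟙 (y ∈? β i)) (w y))) ⟩
    ∑[ y < v ] ∑[ i < n ] (w y * (𝟙 (x ∈? β i) * 𝟙 (y ∈? β i)))
      ≡⟨ sum-cong-≗ (λ y → *-distribˡ-sum (w y) (λ i → 𝟙 (x ∈? β i) * 𝟙 (y ∈? β i))) ⟨
    ∑[ y < v ] (w y * coincidence x y) ∎
    where
    open ≡-Reasoning
    rotate : ∀ a b c → a * (b * c) ≡ c * (a * b)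
    rotate = solve-∀

  module Balanced {λ' : ℕ} (balanced : ∀ x y → x ≢ y → coincidence x y ≡ λ') where

    ∑-through-weight-balanced : ∀ x w →
      ∑-through x (weight w) + λ' * w x ≡ replication x * w x + λ' * sum w
    ∑-through-weight-balanced x w = begin
      ∑-through x (weight w) + λ' * w x              ≡⟨ cong (_+ λ' * w x) (∑-through-weight x w) ⟩
      ∑[ y < v ] (w y * coincidence x y) + λ' * w x  ≡⟨ sum-cong-except _ (λ y → λ' * w y) x off-diagonal ⟩
      w x * coincidence x x + ∑[ y < v ] (λ' * w y)  ≡⟨ cong₂ _+_ diagonal (*-distribˡ-sum λ' w) ⟨
      replication x * w x + λ' * sum w               ∎
      where
      open ≡-Reasoning
      off-diagonal : ∀ y → y ≢ x → w y * coincidence x y ≡ λ' * w y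
      off-diagonal y y≢x = trans (cong (w y *_) (balanced x y (y≢x ∘ sym))) (*-comm (w y) λ')
      diagonal : replication x * w x ≡ w x * coincidence x x
      diagonal = trans (*-comm (replication x) (w x)) (cong (w x *_) (sym (coincidence-diag x)))

    ∑-through-weight-vanishing : ∀ x w → w x ≡ 0 → ∑-through x (weight w) ≡ λ' * sum w
    ∑-through-weight-vanishing x w wx≡0 = +-cancelʳ-≡ (λ' * w x) _ _ (begin
      ∑-through x (weight w) + λ' * w x  ≡⟨ ∑-through-weight-balanced x w ⟩
      replication x * w x + λ' * sum w   ≡⟨ cong (_+ λ' * sum w) (times-w[x] (replication x)) ⟩
      λ' * sum w                         ≡⟨ +-identityʳ (λ' * sum w) ⟨
      λ' * sum w + 0                     ≡⟨ cong (λ' * sum w +_) (times-w[x] λ') ⟨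
      λ' * sum w + λ' * w x              ∎)
      where
      open ≡-Reasoning
      times-w[x] : ∀ a → a * w x ≡ 0
      times-w[x] a = trans (cong (a *_) wx≡0) (*-zeroʳ a)

    replication-equation : ∀ {k} → (∀ i → ∣ β i ∣ ≡ k) →
                           ∀ x → replication x * k + λ' ≡ replication x + λ' * v
    replication-equation {k} ∣β∣≡k x = begin
      replication x * k + λ'
        ≡⟨ cong₂ _+_ (∑-through-const x k) (*-identityʳ λ') ⟨
      ∑-through x (λ _ → k) + λ' * 1
        ≡⟨ cong (_+ λ' * 1) (∑-through-cong x (λ i _ → sym (size i))) ⟩
      ∑-through x (weight (λ _ → 1)) + λ' * 1
        ≡⟨ ∑-through-weight-balanced x (λ _ → 1) ⟩
      replication x * 1 + λ' * ∑[ y < v ] 1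
        ≡⟨ cong₂ _+_ (*-identityʳ _) (cong (λ' *_) (trans (sum-const v 1) (*-identityʳ v))) ⟩
      replication x + λ' * v ∎
      where
      open ≡-Reasoning
      size : ∀ i → weight (λ _ → 1) i ≡ k
      size i = begin
        weight (λ _ → 1) i        ≡⟨ sum-cong-≗ (λ y → *-identityʳ (𝟙 (y ∈? β i))) ⟩
        ∑[ y < v ] 𝟙 (y ∈? β i)  ≡⟨ ∣p∣≡∑∈ (β i) ⟨
        ∣ β i ∣                   ≡⟨ ∣β∣≡k i ⟩
        k                         ∎

pairCount≡coincidence : ∀ {v} (B : List (Subset v)) x y →
                        pairCount B x y ≡ Incidence.coincidence (lookup B) x y
pairCount≡coincidence B x y = begin
  length (filter both? B)                      ≡⟨ cong (length ∘ filter both?) (tabulate-lookup B) ⟨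
  length (filter both? (tabulate (lookup B)))  ≡⟨ length-filter-tabulate both? (lookup B) ⟩
  ∑[ i < length B ] 𝟙 (both? (lookup B i))     ≡⟨ sum-cong-≗ (λ i → 𝟙-×-dec (x ∈? lookup B i) (y ∈? lookup B i)) ⟩
  Incidence.coincidence (lookup B) x y         ∎
  where
  open ≡-Reasoning
  both? = λ b → (x ∈? b) ×-dec (y ∈? b)

module _ {v ℓ} (c : Fin v → Fin ℓ) where

  colourCount≡∑ : ∀ b j → colourCount c b j ≡ ∑[ y < v ] (𝟙 (y ∈? b) * 𝟙 (c y ≟ᶠ j))
  colourCount≡∑ b j = trans (length-filter-tabulate (λ y → (y ∈? b) ×-dec (c y ≟ᶠ j)) id)
                            (sum-cong-≗ (λ y → 𝟙-×-dec (y ∈? b) (c y ≟ᶠ j)))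

  colourCount-own≢0 : ∀ {b x} → x ∈ b → colourCount c b (c x) ≢ 0
  colourCount-own≢0 {b} {x} x∈b =
    length≢0 (∈-filter⁺ (λ y → (y ∈? b) ×-dec (c y ≟ᶠ c x)) (∈-allFin x) (x∈b , refl))

module ULSEColouring {v k ℓ} {B : List (Subset v)} {c : Fin v → Fin ℓ}
                     (ulse : Is0ULSE k ℓ B c) (k≢0 : NonZero k) where

  open Is0ULSE ulse using (missing) renaming (divides to ℓ∸1∣k)

  m : ℕ
  m = _∣_.quotient ℓ∸1∣k

  k≡m*[ℓ∸1] : k ≡ m * (ℓ ∸ 1)
  k≡m*[ℓ∸1] = _∣_.equality ℓ∸1∣k

  instance
    m≢0 : NonZero m
    m≢0 = m*n≢0⇒m≢0 m {{subst NonZero k≡m*[ℓ∸1] k≢0}}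

    ℓ∸1≢0 : NonZero (ℓ ∸ 1)
    ℓ∸1≢0 = m*n≢0⇒n≢0 m {{subst NonZero k≡m*[ℓ∸1] k≢0}}

  1<ℓ : 1 < ℓ
  1<ℓ = ≰⇒> (λ ℓ≤1 → ≢-nonZero⁻¹ (ℓ ∸ 1) (m≤n⇒m∸n≡0 ℓ≤1))

  colourCount≢0⇒≡m : ∀ {b} j → b List.∈ B → colourCount c b j ≢ 0 → colourCount c b j ≡ m
  colourCount≢0⇒≡m j b∈B cc≢0 with missing _ b∈B
  ... | j₀ , cc≡0 , others with j ≟ᶠ j₀
  ...   | yes refl = contradiction cc≡0 cc≢0
  ...   | no j≢j₀  = *-cancelʳ-≡ _ m (ℓ ∸ 1) (trans (others j j≢j₀) k≡m*[ℓ∸1])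

  colourCount+m*absent≡m : ∀ {b} j → b List.∈ B →
                           colourCount c b j + m * 𝟙 (colourCount c b j ≟ 0) ≡ m
  colourCount+m*absent≡m j b∈B = n+m*𝟙[n≟0]≡m (colourCount≢0⇒≡m j b∈B)

  ∑-absent≡1 : ∀ {b} → b List.∈ B → ∑[ j < ℓ ] 𝟙 (colourCount c b j ≟ 0) ≡ 1
  ∑-absent≡1 {b} b∈B with missing b b∈B
  ... | j₀ , cc≡0 , others = begin
    ∑[ j < ℓ ] absent j       ≡⟨ +-identityʳ _ ⟨
    ∑[ j < ℓ ] absent j + 0   ≡⟨ sum-cong-except absent (λ _ → 0) j₀ present ⟩
    absent j₀ + ∑[ j < ℓ ] 0  ≡⟨ cong₂ _+_ (𝟙-yes (colourCount c b j₀ ≟ 0) cc≡0) (sum-replicate-zero ℓ) ⟩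
    1                         ∎
    where
    open ≡-Reasoning
    absent : Fin ℓ → ℕ
    absent j = 𝟙 (colourCount c b j ≟ 0)
    present : ∀ j → j ≢ j₀ → absent j ≡ 0
    present j j≢j₀ = 𝟙-no (colourCount c b j ≟ 0)
      (λ cc≡0 → ≢-nonZero⁻¹ k {{k≢0}} (trans (sym (others j j≢j₀)) (cong (_* (ℓ ∸ 1)) cc≡0)))

-- The blocks are indexed by Fin (length B) through lookup B, so that
-- double counting becomes an exchange of two finite sums.
module ULSEDesign {v k λ' ℓ r} {B : List (Subset v)} {c : Fin v → Fin ℓ}
                  (design : IsBIBD v k λ' B) (ulse : Is0ULSE k ℓ B c)
                  (r-eq : r * (k ∸ 1) ≡ λ' * (v ∸ 1)) where

  open IsBIBD design
  open Is0ULSE ulse using (colouring)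
  open Incidence (lookup B)
  open Balanced (λ x y x≢y → trans (sym (pairCount≡coincidence B x y)) (balanced x y x≢y))

  k≢0 : NonZero k
  k≢0 = >-nonZero (≤-trans (s≤s z≤n) two≤k)

  instance
    k∸1≢0 : NonZero (k ∸ 1)
    k∸1≢0 = >-nonZero (∸-monoˡ-≤ 1 two≤k)

  open ULSEColouring ulse k≢0 public

  replication≡r : ∀ x → replication x ≡ r
  replication≡r x = *-cancelʳ-≡ (replication x) r (k ∸ 1) (begin
    replication x * (k ∸ 1)  ≡⟨ a*k+b≡a+b*v⇒a*[k∸1]≡b*[v∸1] (replication x) λ' 1≤k 1≤v replication-eq ⟩
    λ' * (v ∸ 1)             ≡⟨ r-eq ⟨
    r * (k ∸ 1)              ∎)
    where
    open ≡-Reasoning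
    1≤k : 1 ≤ k
    1≤k = ≤-trans (s≤s z≤n) two≤k
    1≤v : 1 ≤ v
    1≤v = ≤-trans (s≤s z≤n) k<v
    replication-eq : replication x * k + λ' ≡ replication x + λ' * v
    replication-eq = replication-equation (λ i → blockSize (lookup B i) (∈-lookup i)) x

  blockColourCount : Fin (length B) → Fin ℓ → ℕ
  blockColourCount i j = colourCount c (lookup B i) j

  colourIndicator : Fin ℓ → Fin v → ℕ
  colourIndicator j y = 𝟙 (c y ≟ᶠ j)

  classSize : Fin ℓ → ℕ
  classSize j = sum (colourIndicator j)

  missCount : Fin v → Fin ℓ → ℕ
  missCount x j = ∑-through x (λ i → 𝟙 (blockColourCount i j ≟ 0))

  ∑-through-blockColourCount : ∀ x j → ∑-through x (λ i → blockColourCount i j)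
                                       ≡ ∑-through x (weight (colourIndicator j))
  ∑-through-blockColourCount x j = ∑-through-cong x (λ i _ → colourCount≡∑ c (lookup B i) j)

  own-colour-count : ∀ z → r * m + λ' ≡ r + λ' * classSize (c z)
  own-colour-count z = begin
    r * m + λ'
      ≡⟨ cong₂ _+_ through-m (*-identityʳ λ') ⟨
    ∑-through z (λ i → blockColourCount i (c z)) + λ' * 1
      ≡⟨ cong₂ (λ s t → s + λ' * t) (∑-through-blockColourCount z (c z)) (sym own) ⟩
    ∑-through z (weight w) + λ' * w z
      ≡⟨ ∑-through-weight-balanced z w ⟩
    replication z * w z + λ' * sum w
      ≡⟨ cong (_+ λ' * sum w) (trans (cong₂ _*_ (replication≡r z) own) (*-identityʳ r)) ⟩
    r + λ' * sum w ∎
    where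
    open ≡-Reasoning
    w = colourIndicator (c z)
    own : w z ≡ 1
    own = 𝟙-yes (c z ≟ᶠ c z) refl
    through-m : ∑-through z (λ i → blockColourCount i (c z)) ≡ r * m
    through-m = begin
      ∑-through z (λ i → blockColourCount i (c z))  ≡⟨ ∑-through-cong z present ⟩
      ∑-through z (λ _ → m)                         ≡⟨ ∑-through-const z m ⟩
      replication z * m                             ≡⟨ cong (_* m) (replication≡r z) ⟩
      r * m                                         ∎
      where
      present : ∀ i → z ∈ lookup B i → blockColourCount i (c z) ≡ m
      present i z∈ = colourCount≢0⇒≡m (c z) (∈-lookup i) (colourCount-own≢0 c z∈)

  foreign-colour-count : ∀ x j → j ≢ c x → λ' * classSize j + m * missCount x j ≡ r * m
  foreign-colour-count x j j≢cx = begin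
    λ' * classSize j + m * missCount x j
      ≡⟨ cong (_+ m * missCount x j) through-λN ⟨
    ∑-through x (λ i → blockColourCount i j) + m * missCount x j
      ≡⟨ ∑-through-linear x _ _ m ⟩
    ∑-through x (λ i → blockColourCount i j + m * 𝟙 (blockColourCount i j ≟ 0))
      ≡⟨ ∑-through-cong x (λ i _ → colourCount+m*absent≡m j (∈-lookup i)) ⟩
    ∑-through x (λ _ → m)
      ≡⟨ trans (∑-through-const x m) (cong (_* m) (replication≡r x)) ⟩
    r * m ∎
    where
    open ≡-Reasoning
    through-λN : ∑-through x (λ i → blockColourCount i j) ≡ λ' * classSize j
    through-λN = trans (∑-through-blockColourCount x j)
                       (∑-through-weight-vanishing x _ (𝟙-no (c x ≟ᶠ j) (j≢cx ∘ sym)))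

  missCount-equation : ∀ x j → j ≢ c x → m * missCount x j + λ' ≡ r
  missCount-equation x j j≢cx with colouring j
  ... | z , cz≡j = +-cancelʳ-≡ (r * m) _ _ (begin
    R + λ' + r * m                  ≡⟨ xy∙z≈x∙zy +-commutativeSemigroup R λ' (r * m) ⟩
    R + (r * m + λ')                ≡⟨ cong (R +_) (own-colour-count z) ⟩
    R + (r + λ' * classSize (c z))  ≡⟨ cong (λ j′ → R + (r + λ' * classSize j′)) (cz≡j refl) ⟩
    R + (r + λ' * classSize j)      ≡⟨ x∙yz≈y∙xz +-commutativeSemigroup R r (λ' * classSize j) ⟩
    r + (R + λ' * classSize j)      ≡⟨ cong (r +_) (+-comm R (λ' * classSize j)) ⟩
    r + (λ' * classSize j + R)      ≡⟨ cong (r +_) (foreign-colour-count x j j≢cx) ⟩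
    r + r * m                       ∎)
    where
    open ≡-Reasoning
    R = m * missCount x j

  missCount-uniform : ∀ x {j j′} → j ≢ c x → j′ ≢ c x → missCount x j ≡ missCount x j′
  missCount-uniform x {j} {j′} j≢cx j′≢cx = *-cancelˡ-≡ _ _ m (+-cancelʳ-≡ λ' _ _
    (trans (missCount-equation x j j≢cx) (sym (missCount-equation x j′ j′≢cx))))

  missCount-own : ∀ x → missCount x (c x) ≡ 0
  missCount-own x = begin
    missCount x (c x)      ≡⟨ ∑-through-cong x (λ i x∈ → 𝟙-no (_ ≟ 0) (colourCount-own≢0 c x∈)) ⟩
    ∑-through x (λ _ → 0)  ≡⟨ ∑-through-const x 0 ⟩
    replication x * 0      ≡⟨ *-zeroʳ (replication x) ⟩
    0                      ∎
    where open ≡-Reasoning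

  ∑-missCount : ∀ x → ∑[ j < ℓ ] missCount x j ≡ r
  ∑-missCount x = begin
    ∑[ j < ℓ ] missCount x j
      ≡⟨ ∑-comm (λ j i → 𝟙 (x ∈? lookup B i) * absent i j) ⟩
    ∑[ i < length B ] ∑[ j < ℓ ] (𝟙 (x ∈? lookup B i) * absent i j)
      ≡⟨ sum-cong-≗ (λ i → *-distribˡ-sum (𝟙 (x ∈? lookup B i)) (absent i)) ⟨
    ∑-through x (λ i → ∑[ j < ℓ ] absent i j)
      ≡⟨ ∑-through-cong x (λ i _ → ∑-absent≡1 (∈-lookup i)) ⟩
    ∑-through x (λ _ → 1)
      ≡⟨ ∑-through-const x 1 ⟩
    replication x * 1
      ≡⟨ trans (*-identityʳ _) (replication≡r x) ⟩
    r ∎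
    where
    open ≡-Reasoning
    absent : Fin (length B) → Fin ℓ → ℕ
    absent i j = 𝟙 (blockColourCount i j ≟ 0)

theorem3p9 : (v k λ' ℓ r : ℕ) (B : List (Subset v)) (c : Fin v → Fin ℓ) →
    IsBIBD v k λ' B → Is0ULSE k ℓ B c →
    r * (k ∸ 1) ≡ λ' * (v ∸ 1) →
    (ℓ ∸ 1) ∣ r
theorem3p9 v k λ' ℓ r B c design ulse r-eq = divides t (m+n≡o*n⇒m≡n*[o∸1] {o = ℓ} r+t≡ℓ*t)
  where
  open ULSEDesign {r = r} design ulse r-eq
  x : Fin v
  x = fromℕ< (≤-<-trans z≤n (IsBIBD.k<v design))
  j₁≢cx : ∃[ j₁ ] j₁ ≢ c x
  j₁≢cx = another 1<ℓ (c x)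
  t : ℕ
  t = missCount x (proj₁ j₁≢cx)
  r+t≡ℓ*t : r + t ≡ ℓ * t
  r+t≡ℓ*t = begin
    r + t                              ≡⟨ cong (_+ t) (∑-missCount x) ⟨
    ∑[ j < ℓ ] missCount x j + t       ≡⟨ sum-cong-except (missCount x) (λ _ → t) (c x)
                                            (λ j j≢cx → missCount-uniform x j≢cx (proj₂ j₁≢cx)) ⟩
    missCount x (c x) + ∑[ j < ℓ ] t   ≡⟨ cong₂ _+_ (missCount-own x) (sum-const ℓ t) ⟩
    ℓ * t                              ∎
    where open ≡-Reasoning
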